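{- There exists a signed graph $(G,\sigma)$ such that $G$ contains none of $P_4$, $P_3+P_2$ and $P_2+P_2+P_2$ as an induced subgraph, but $(G,\sigma)$ is neither $(\psi,\omega)$-perfect nor $(\psi,\chi)$-perfect.
   Context: $P_m$ is the path on $m$ vertices and $+$ denotes disjoint union. A signed graph $(G,\sigma)$ is a finite simple graph $G$ with a signature $\sigma:E(G)\to\{ -,+\}$; induced subgraphs inherit the signature. Switching a set $S\subseteq V(G)$ changes the sign of every edge with exactly one end in $S$; two signed graphs on the same underlying graph are equivalent if one is obtained from the other by switching some set of vertices. For $k\ge1$ let $M_k=\{ -n,\dots,-1,+1,\dots,+n\}$ if $k=2n$, and $M_k=\{ -n,\dots,-1,\pm0,+1,\dots,+n\}$ if $k=2n+1$, where $\pm0$ is a single colour with $-(\pm0)=\pm0$. A $k$-colouring $\phi:V(G)\to M_k$ is proper if $\phi(u)\ne\sigma(uv)\phi(v)$ for every edge $uv$ (where $\sigma(uv)\phi(v)=\phi(v)$ if $\sigma(uv)=+$ and $-\phi(v)$ otherwise); the chromatic number $\chi(G,\sigma)$ is the smallest $k$ admitting a proper $k$-colouring. Let $K_k^*$ be the signed multigraph with vertex set $\{i\ge 0: +i\in M_k\}$ (vertex $0$ standing for colour $\pm0$ when $k$ is odd), in which every two distinct vertices are joined by exactly one positive and one negative edge, and every vertex $i\neq0$ carries exactly one negative loop. Given a $k$-colouring $\phi$, the reduced signed graph $R(G,\sigma,\phi)$ is obtained by (1) switching every vertex with a negative colour $-i$ and recolouring it $+i$; (2) identifying, for each $i$, all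 vertices of colour $+i$ (resp. $\pm0$) into a single vertex $i$ (resp. $0$), edges inside a class becoming loops; (3) keeping at most one positive and at most one negative edge (or loop) between any two vertices (or at any vertex). The colouring $\phi$ is complete if $R(G,\sigma,\phi)$ is exactly $K_k^*$. The achromatic number $\psi(G,\sigma)$ is the largest $k\ge1$ such that some signed graph equivalent to $(G,\sigma)$ admits a complete $k$-colouring. The clique number $\omega(G,\sigma)$ is the clique number $\omega(G)$ of the underlying graph. For distinct $\alpha,\beta\in\{\omega,\chi,\psi\}$, $(G,\sigma)$ is $(\alpha,\beta)$-perfect if $\alpha(H,\sigma)=\beta(H,\sigma)$ for every induced subgraph $H$ of $G$. -}

module Defs where

open import Data.Bool using (Bool; true; false; _∨_)
open import Data.Nat as ℕ using (ℕ; zero; suc; _≤_; _%_; _≡ᵇ_)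
open import Data.Integer as ℤ using (ℤ; +_; -_; ∣_∣; sign)
open import Data.Sign as Sign using (Sign)
open import Data.Fin using (Fin; toℕ; splitAt)
open import Data.Sum using (_⊎_; inj₁; inj₂)
open import Data.Product using (Σ; ∃; ∃₂; _×_; _,_)
open import Relation.Binary.PropositionalEquality using (_≡_; _≢_)
open import Function.Definitions using (Injective)

Adj : ℕ → Set
Adj n = Fin n → Fin n → Bool

-- Signatures: a sign for every (ordered) pair; only edges matter.
Sig : ℕ → Set
Sig n = Fin n → Fin n → Sign

record SGraph (n : ℕ) : Set where
  field
    adj     : Adj n
    adj-sym : ∀ u v → adj u v ≡ adj v u
    irrefl  : ∀ u → adj u u ≡ false
    sig     : Sig n
    sig-sym : ∀ u v → sig u v ≡ sig v u
open SGraph public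

P : (m : ℕ) → Adj m
P m i j = (toℕ i ≡ᵇ suc (toℕ j)) ∨ (toℕ j ≡ᵇ suc (toℕ i))

infixr 5 _⊕_
_⊕_ : ∀ {m k} → Adj m → Adj k → Adj (m ℕ.+ k)
_⊕_ {m} A B i j with splitAt m i | splitAt m j
... | inj₁ a | inj₁ b = A a b
... | inj₂ a | inj₂ b = B a b
... | inj₁ _ | inj₂ _ = false
... | inj₂ _ | inj₁ _ = false

ContainsInduced : ∀ {m n} → Adj m → Adj n → Set
ContainsInduced {m} {n} H G =
  Σ (Fin m → Fin n) λ f → Injective _≡_ _≡_ f × (∀ i j → G (f i) (f j) ≡ H i j)

restrictAdj : ∀ {m n} → (Fin m → Fin n) → Adj n → Adj m
restrictAdj f A i j = A (f i) (f j)

restrictSig : ∀ {m n} → (Fin m → Fin n) → Sig n → Sig m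
restrictSig f σ i j = σ (f i) (f j)

-- Colours.  M_k is encoded as a set of integers: the colour ±i is the
-- integer ±i, and the colour ±0 (k odd) is the integer 0.

Odd : ℕ → Set
Odd k = k % 2 ≡ 1

InM : ℕ → ℤ → Set
InM k c = (c ≡ + 0 → Odd k) × (2 ℕ.* ∣ c ∣ ≤ k)

act : Sign → ℤ → ℤ
act Sign.+ c = c
act Sign.- c = - c

Proper : ∀ {n} → Adj n → Sig n → ℕ → (Fin n → ℤ) → Set
Proper A σ k φ =
  (∀ v → InM k (φ v)) ×
  (∀ u v → A u v ≡ true → φ u ≢ act (σ u v) (φ v))

Colourable : ∀ {n} → Adj n → Sig n → ℕ → Set
Colourable {n} A σ k = Σ (Fin n → ℤ) λ φ → Proper A σ k φ

sw : Bool → Sign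
sw true  = Sign.-
sw false = Sign.+

switch : ∀ {n} → (Fin n → Bool) → Sig n → Sig n
switch S σ u v = sw (S u) Sign.* σ u v Sign.* sw (S v)

-- Complete colourings.
-- Vertices of K_k^* : the i ≥ 0 with +i ∈ M_k.
KVert : ℕ → ℕ → Set
KVert k i = InM k (+ i)

-- Sign of the edge uv after step (1) of the reduction (switching every
-- vertex with a negative colour); vertex v then lies in class ∣ φ v ∣.
redSig : ∀ {n} → Sig n → (Fin n → ℤ) → Sig n
redSig σ φ u v = sign (φ u) Sign.* σ u v Sign.* sign (φ v)

-- φ is a complete k-colouring: φ maps into M_k and R(G,σ,φ) = K_k^*.
Complete : ∀ {n} → Adj n → Sig n → ℕ → (Fin n → ℤ) → Set
Complete {n} A σ k φ =
  (∀ v → InM k (φ v)) ×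
  -- every vertex of K_k^* is a vertex of R
  (∀ i → KVert k i → ∃ λ v → ∣ φ v ∣ ≡ i) ×
  -- distinct vertices i, j of K_k^* are joined in R by an edge of each sign
  (∀ i j → KVert k i → KVert k j → i ≢ j → ∀ s →
     ∃₂ λ u v → A u v ≡ true × ∣ φ u ∣ ≡ i × ∣ φ v ∣ ≡ j × redSig σ φ u v ≡ s) ×
  -- every vertex i ≠ 0 of K_k^* carries a negative loop in R
  (∀ i → KVert k i → i ≢ 0 →
     ∃₂ λ u v → A u v ≡ true × ∣ φ u ∣ ≡ i × ∣ φ v ∣ ≡ i × redSig σ φ u v ≡ Sign.-) ×
  -- R has no other loops: no loop at 0 and no positive loops
  (∀ u v → A u v ≡ true → ∣ φ u ∣ ≡ ∣ φ v ∣ →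
     ∣ φ u ∣ ≢ 0 × redSig σ φ u v ≡ Sign.-)

HasComplete : ∀ {n} → Adj n → Sig n → ℕ → Set
HasComplete {n} A σ k =
  Σ (Fin n → Bool) λ S → Σ (Fin n → ℤ) λ φ → Complete A (switch S σ) k φ

IsClique : ∀ {n m} → Adj n → (Fin m → Fin n) → Set
IsClique {n} {m} A f = ∀ i j → i ≢ j → A (f i) (f j) ≡ true

IsOmega : ∀ {n} → Adj n → Sig n → ℕ → Set
IsOmega {n} A σ k =
  (Σ (Fin k → Fin n) λ f → IsClique A f) ×
  (∀ m (f : Fin m → Fin n) → IsClique A f → m ≤ k)

IsChi : ∀ {n} → Adj n → Sig n → ℕ → Set
IsChi A σ k =
  1 ≤ k × Colourable A σ k × (∀ j → 1 ≤ j → Colourable A σ j → k ≤ j)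

IsPsi : ∀ {n} → Adj n → Sig n → ℕ → Set
IsPsi A σ k =
  1 ≤ k × HasComplete A σ k × (∀ j → 1 ≤ j → HasComplete A σ j → j ≤ k)

Param : Set₁
Param = ∀ {n} → Adj n → Sig n → ℕ → Set

Perfect : Param → Param → ∀ {n} → SGraph n → Set
Perfect α β {n} G =
  ∀ m (f : Fin m → Fin n) → Injective _≡_ _≡_ f →
  ∀ a b → α (restrictAdj f (adj G)) (restrictSig f (sig G)) a →
          β (restrictAdj f (adj G)) (restrictSig f (sig G)) b → a ≡ b

-- The unbalanced 4-cycle (one negative edge) is a counterexample.  Being
-- a 4-cycle it is triangle-free and has no induced P₄ (two non-adjacent
-- vertices of a 4-cycle are antipodal), and it has too few vertices to
-- contain P₃ + P₂ or P₂ + P₂ + P₂.  Its clique number is 2 and, being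
-- unbalanced, it is not 2-colourable, so χ = 3.  The colouring
-- (+1, +1, +2, −2) around the cycle is complete, so ψ ≥ 4; and ψ ≤ 4
-- since a complete k-colouring with k ≥ 5 needs two adjacent vertices in
-- each of the classes 1 and 2 plus a vertex in a third class.
module Submission where

open import Defs
open import Data.Nat using (ℕ)
open import Data.Product using (Σ; _×_)
open import Relation.Nullary using (¬_)

open import Data.Bool as Bool using (Bool; true; false; if_then_else_)
open import Data.Nat as ℕ using (zero; suc; z≤n; s≤s; _≤_)
open import Data.Nat.Properties as ℕ using ()
open import Data.Integer as ℤ using (ℤ; +_; -_; ∣_∣; -[1+_])
open import Data.Integer.Properties as ℤ using ()
open import Data.Sign as Sign using (Sign)
open import Data.Fin as Fin using (Fin)
open import Data.Fin.Patterns using (0F; 1F; 2F; 3F; 4F)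
open import Data.Fin.Properties using (all?; injective⇒≤)
open import Data.Sum using (_⊎_; inj₁; inj₂)
open import Data.Product using (∃; ∃₂; _,_)
open import Data.Unit using (tt)
open import Data.Empty using (⊥-elim)
open import Function using (_∘_)
open import Relation.Binary.PropositionalEquality
open import Relation.Nullary using (does; yes; no; contradiction)
open import Relation.Nullary.Decidable
  using (toWitness; ¬?; _→-dec_; _×-dec_; dec-true; dec-false)

smaller-host⇒¬induced : ∀ {m n} {H : Adj m} {G : Adj n} → n ℕ.< m → ¬ ContainsInduced H G
smaller-host⇒¬induced n<m (_ , f-injective , _) = ℕ.<⇒≱ n<m (injective⇒≤ f-injective)

adjacent⇒distinct : ∀ {n} {A : Adj n} → (∀ u → A u u ≡ false) →
                    ∀ {u v} → A u v ≡ true → u ≢ v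
adjacent⇒distinct irreflexive {u} uv refl with () ← trans (sym uv) (irreflexive u)

triangle-free⇒clique≤2 : ∀ {n} {A : Adj n} →
  (∀ a b c → ¬ (A a b ≡ true × A b c ≡ true × A a c ≡ true)) →
  ∀ m (f : Fin m → Fin n) → IsClique A f → m ≤ 2
triangle-free⇒clique≤2 _ 0 _ _ = z≤n
triangle-free⇒clique≤2 _ 1 _ _ = s≤s z≤n
triangle-free⇒clique≤2 _ 2 _ _ = s≤s (s≤s z≤n)
triangle-free⇒clique≤2 triangle-free (suc (suc (suc m))) f clique =
  ⊥-elim (triangle-free (f 0F) (f 1F) (f 2F)
    (clique 0F 1F (λ ()) , clique 1F 2F (λ ()) , clique 0F 2F (λ ())))

¬Perfect-whole : ∀ {α β : Param} {n} (G : SGraph n) {a b} →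
  α (adj G) (sig G) a → β (adj G) (sig G) b → a ≢ b → ¬ Perfect α β G
¬Perfect-whole {n = n} _ {a} {b} αa βb a≢b perfect =
  a≢b (perfect n (λ v → v) (λ e → e) a b αa βb)

M₁-colour : ∀ {c} → InM 1 c → c ≡ + 0
M₁-colour {c} (_ , 2∣c∣≤1) =
  ℤ.∣i∣≡0⇒i≡0 (ℕ.n<1⇒n≡0 (ℕ.*-cancelˡ-< 2 ∣ c ∣ 1 (s≤s 2∣c∣≤1)))

M₂-colour : ∀ {c} → InM 2 c → c ≡ + 1 ⊎ c ≡ - + 1
M₂-colour {c} (odd , 2∣c∣≤2) with c | ℕ.*-cancelˡ-≤ {∣ c ∣} {1} 2 2∣c∣≤2
... | + 0           | _ with () ← odd refl
... | + 1           | _ = inj₁ refl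
... | -[1+ 0 ]      | _ = inj₂ refl
... | + suc (suc _) | s≤s ()
... | -[1+ suc _ ]  | s≤s ()

M₂-≢-neg : ∀ {c} → InM 2 c → c ≢ - c
M₂-≢-neg c∈M₂ with M₂-colour c∈M₂
... | inj₁ refl = λ ()
... | inj₂ refl = λ ()

M₂-proper-edge : ∀ {c d} s → InM 2 c → InM 2 d →
                 c ≢ act s d → c ≡ act (Sign.opposite s) d
M₂-proper-edge s c∈M₂ d∈M₂ c≢sd with M₂-colour c∈M₂ | M₂-colour d∈M₂ | s
... | inj₁ refl | inj₁ refl | Sign.+ = ⊥-elim (c≢sd refl)
... | inj₁ refl | inj₁ refl | Sign.- = refl
... | inj₁ refl | inj₂ refl | Sign.+ = refl
... | inj₁ refl | inj₂ refl | Sign.- = ⊥-elim (c≢sd refl)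
... | inj₂ refl | inj₁ refl | Sign.+ = refl
... | inj₂ refl | inj₁ refl | Sign.- = ⊥-elim (c≢sd refl)
... | inj₂ refl | inj₂ refl | Sign.+ = ⊥-elim (c≢sd refl)
... | inj₂ refl | inj₂ refl | Sign.- = refl

K₄-vertex : ∀ {i} → KVert 4 i → i ≡ 1 ⊎ i ≡ 2
K₄-vertex {i} (odd , 2i≤4) with i | ℕ.*-cancelˡ-≤ {i} {2} 2 2i≤4
... | 0 | _ with () ← odd refl
... | 1 | _ = inj₁ refl
... | 2 | _ = inj₂ refl
... | suc (suc (suc _)) | s≤s (s≤s ())

third-K-vertex : ∀ k → ∃ λ t → KVert (5 ℕ.+ k) t × t ≢ 1 × t ≢ 2
third-K-vertex zero    = 0 , ((λ _ → refl) , z≤n) , (λ ()) , (λ ())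
third-K-vertex (suc k) = 3 , ((λ ()) , ℕ.m≤m+n 6 k) , (λ ()) , (λ ())

-- The labels, together with u₁ and u₂, decode the five vertices.
two-two-one⇒5≤n : ∀ {n} (c : Fin n → ℕ) {u₁ v₁ u₂ v₂ w : Fin n} →
  u₁ ≢ v₁ → u₂ ≢ v₂ → c u₁ ≡ 1 → c v₁ ≡ 1 → c u₂ ≡ 2 → c v₂ ≡ 2 →
  c w ≢ 1 → c w ≢ 2 → 5 ≤ n
two-two-one⇒5≤n {n} c {u₁} {v₁} {u₂} {v₂} {w} u₁≢v₁ u₂≢v₂ cu₁ cv₁ cu₂ cv₂ cw≢1 cw≢2 =
  injective⇒≤ λ {i} {j} gi≡gj →
    trans (sym (decode-vertex i)) (trans (cong decode gi≡gj) (decode-vertex j))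
  where
  vertex : Fin 5 → Fin n
  vertex 0F = u₁
  vertex 1F = v₁
  vertex 2F = u₂
  vertex 3F = v₂
  vertex 4F = w

  decode : Fin n → Fin 5
  decode v =
    if does (c v ℕ.≟ 1) then (if does (v Fin.≟ u₁) then 0F else 1F) else
    if does (c v ℕ.≟ 2) then (if does (v Fin.≟ u₂) then 2F else 3F) else 4F

  2≢1 : ∀ {v} → c v ≡ 2 → c v ≢ 1
  2≢1 cv≡2 cv≡1 with () ← trans (sym cv≡2) cv≡1

  decode-vertex : ∀ i → decode (vertex i) ≡ i
  decode-vertex 0F
    rewrite dec-true (c u₁ ℕ.≟ 1) cu₁ | dec-true (u₁ Fin.≟ u₁) refl = refl
  decode-vertex 1F
    rewrite dec-true (c v₁ ℕ.≟ 1) cv₁ | dec-false (v₁ Fin.≟ u₁) (u₁≢v₁ ∘ sym) = refl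
  decode-vertex 2F
    rewrite dec-false (c u₂ ℕ.≟ 1) (2≢1 cu₂) | dec-true (c u₂ ℕ.≟ 2) cu₂
          | dec-true (u₂ Fin.≟ u₂) refl = refl
  decode-vertex 3F
    rewrite dec-false (c v₂ ℕ.≟ 1) (2≢1 cv₂) | dec-true (c v₂ ℕ.≟ 2) cv₂
          | dec-false (v₂ Fin.≟ u₂) (u₂≢v₂ ∘ sym) = refl
  decode-vertex 4F
    rewrite dec-false (c w ℕ.≟ 1) cw≢1 | dec-false (c w ℕ.≟ 2) cw≢2 = refl

complete⇒5≤n : ∀ {n} {A : Adj n} {σ k φ} → (∀ u → A u u ≡ false) →
               Complete A σ k φ → 5 ≤ k → 5 ≤ n
complete⇒5≤n {φ = φ} irreflexive (_ , cover , _ , loop , _) (s≤s (s≤s (s≤s (s≤s (s≤s {n = k} _)))))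
  with third-K-vertex k
... | t , t∈K , t≢1 , t≢2
  with loop 1 ((λ ()) , s≤s (s≤s z≤n)) (λ ()) | loop 2 ((λ ()) , s≤s (s≤s (s≤s (s≤s z≤n)))) (λ ())
     | cover t t∈K
... | u₁ , v₁ , u₁v₁ , cu₁ , cv₁ , _ | u₂ , v₂ , u₂v₂ , cu₂ , cv₂ , _ | w , cw =
  two-two-one⇒5≤n (λ v → ∣ φ v ∣)
    (adjacent⇒distinct irreflexive u₁v₁) (adjacent⇒distinct irreflexive u₂v₂)
    cu₁ cv₁ cu₂ cv₂ (t≢1 ∘ trans (sym cw)) (t≢2 ∘ trans (sym cw))

C₄ : Adj 4
C₄ 0F 1F = true
C₄ 1F 0F = true
C₄ 1F 2F = true
C₄ 2F 1F = true
C₄ 2F 3F = true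
C₄ 3F 2F = true
C₄ 3F 0F = true
C₄ 0F 3F = true
C₄ _  _  = false

σ₄ : Sig 4
σ₄ 0F 1F = Sign.-
σ₄ 1F 0F = Sign.-
σ₄ _  _  = Sign.+

C₄-irreflexive : ∀ u → C₄ u u ≡ false
C₄-irreflexive = toWitness {a? = all? λ u → C₄ u u Bool.≟ false} tt

C₄± : SGraph 4
C₄± = record
  { adj     = C₄
  ; adj-sym = toWitness {a? = all? λ u → all? λ v → C₄ u v Bool.≟ C₄ v u} tt
  ; irrefl  = C₄-irreflexive
  ; sig     = σ₄
  ; sig-sym = toWitness {a? = all? λ u → all? λ v → σ₄ u v Sign.≟ σ₄ v u} tt
  }

antipode : Fin 4 → Fin 4
antipode 0F = 2F
antipode 1F = 3F
antipode 2F = 0F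
antipode 3F = 1F

C₄-nonadjacent⇒antipodal : ∀ u v → u ≢ v → C₄ u v ≡ false → v ≡ antipode u
C₄-nonadjacent⇒antipodal = toWitness {a? = all? λ u → all? λ v →
  ¬? (u Fin.≟ v) →-dec ((C₄ u v Bool.≟ false) →-dec (v Fin.≟ antipode u))} tt

-- In an induced P₄ = f0 f1 f2 f3 both f2 and f3 would be antipodal to f0.
C₄-P₄-free : ¬ ContainsInduced (P 4) C₄
C₄-P₄-free (f , f-injective , induced) = contradiction (f-injective f2≡f3) λ ()
  where
  antipodal-to-f0 : ∀ i → 0F ≢ i → P 4 0F i ≡ false → f i ≡ antipode (f 0F)
  antipodal-to-f0 i 0≢i nonadjacent =
    C₄-nonadjacent⇒antipodal (f 0F) (f i) (0≢i ∘ f-injective) (trans (induced 0F i) nonadjacent)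

  f2≡f3 : f 2F ≡ f 3F
  f2≡f3 = trans (antipodal-to-f0 2F (λ ()) refl) (sym (antipodal-to-f0 3F (λ ()) refl))

C₄-clique-number : IsOmega C₄ σ₄ 2
C₄-clique-number = (edge , edge-clique) , triangle-free⇒clique≤2 triangle-free
  where
  edge : Fin 2 → Fin 4
  edge 0F = 0F
  edge 1F = 1F

  edge-clique : IsClique C₄ edge
  edge-clique 0F 0F 0≢0 = ⊥-elim (0≢0 refl)
  edge-clique 0F 1F _   = refl
  edge-clique 1F 0F _   = refl
  edge-clique 1F 1F 1≢1 = ⊥-elim (1≢1 refl)

  triangle-free : ∀ a b c → ¬ (C₄ a b ≡ true × C₄ b c ≡ true × C₄ a c ≡ true)
  triangle-free = toWitness {a? = all? λ a → all? λ b → all? λ c →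
    ¬? ((C₄ a b Bool.≟ true) ×-dec (C₄ b c Bool.≟ true) ×-dec (C₄ a c Bool.≟ true))} tt

C₄-not-1-colourable : ¬ Colourable C₄ σ₄ 1
C₄-not-1-colourable (φ , colours , proper) =
  proper 1F 2F refl (trans (M₁-colour (colours 1F)) (sym (M₁-colour (colours 2F))))

-- Around the cycle the colour is multiplied by −σ(e) on each edge, and
-- the product of the −σ(e) is −1 since exactly one edge is negative.
C₄-not-2-colourable : ¬ Colourable C₄ σ₄ 2
C₄-not-2-colourable (φ , colours , proper) = M₂-≢-neg (colours 0F) (begin
  φ 0F       ≡⟨ edge 0F 1F refl ⟩
  φ 1F       ≡⟨ edge 1F 2F refl ⟩
  - φ 2F     ≡⟨ cong -_ (edge 2F 3F refl) ⟩
  - - φ 3F   ≡⟨ ℤ.neg-involutive (φ 3F) ⟩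
  φ 3F       ≡⟨ edge 3F 0F refl ⟩
  - φ 0F     ∎)
  where
  open ≡-Reasoning
  edge : ∀ u v → C₄ u v ≡ true → φ u ≡ act (Sign.opposite (σ₄ u v)) (φ v)
  edge u v uv = M₂-proper-edge (σ₄ u v) (colours u) (colours v) (proper u v uv)

C₄-3-colouring : Fin 4 → ℤ
C₄-3-colouring 0F = + 0
C₄-3-colouring 1F = + 1
C₄-3-colouring 2F = - + 1
C₄-3-colouring 3F = + 1

C₄-chromatic-number : IsChi C₄ σ₄ 3
C₄-chromatic-number = s≤s z≤n , (C₄-3-colouring , colours , proper) , minimal
  where
  colours : ∀ v → InM 3 (C₄-3-colouring v)
  colours 0F = (λ _ → refl) , z≤n
  colours 1F = (λ _ → refl) , s≤s (s≤s z≤n)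
  colours 2F = (λ _ → refl) , s≤s (s≤s z≤n)
  colours 3F = (λ _ → refl) , s≤s (s≤s z≤n)

  proper : ∀ u v → C₄ u v ≡ true → C₄-3-colouring u ≢ act (σ₄ u v) (C₄-3-colouring v)
  proper = toWitness {a? = all? λ u → all? λ v → (C₄ u v Bool.≟ true) →-dec
    ¬? (C₄-3-colouring u ℤ.≟ act (σ₄ u v) (C₄-3-colouring v))} tt

  minimal : ∀ j → 1 ≤ j → Colourable C₄ σ₄ j → 3 ≤ j
  minimal 1 _ colourable = ⊥-elim (C₄-not-1-colourable colourable)
  minimal 2 _ colourable = ⊥-elim (C₄-not-2-colourable colourable)
  minimal (suc (suc (suc j))) _ _ = s≤s (s≤s (s≤s z≤n))

C₄-4-colouring : Fin 4 → ℤ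
C₄-4-colouring 0F = + 1
C₄-4-colouring 1F = + 1
C₄-4-colouring 2F = + 2
C₄-4-colouring 3F = - + 2

unswitched : Fin 4 → Bool
unswitched _ = false

C₄-complete-4-colouring : Complete C₄ (switch unswitched σ₄) 4 C₄-4-colouring
C₄-complete-4-colouring = colours , cover , joins , loops , no-other-loops
  where
  φ = C₄-4-colouring
  σ = switch unswitched σ₄

  colours : ∀ v → InM 4 (φ v)
  colours 0F = (λ ()) , s≤s (s≤s z≤n)
  colours 1F = (λ ()) , s≤s (s≤s z≤n)
  colours 2F = (λ ()) , s≤s (s≤s (s≤s (s≤s z≤n)))
  colours 3F = (λ ()) , s≤s (s≤s (s≤s (s≤s z≤n)))

  cover : ∀ i → KVert 4 i → ∃ λ v → ∣ φ v ∣ ≡ i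
  cover i i∈K with K₄-vertex i∈K
  ... | inj₁ refl = 0F , refl
  ... | inj₂ refl = 2F , refl

  joins : ∀ i j → KVert 4 i → KVert 4 j → i ≢ j → ∀ s →
    ∃₂ λ u v → C₄ u v ≡ true × ∣ φ u ∣ ≡ i × ∣ φ v ∣ ≡ j × redSig σ φ u v ≡ s
  joins i j i∈K j∈K i≢j s with K₄-vertex i∈K | K₄-vertex j∈K | s
  ... | inj₁ refl | inj₁ refl | _      = ⊥-elim (i≢j refl)
  ... | inj₂ refl | inj₂ refl | _      = ⊥-elim (i≢j refl)
  ... | inj₁ refl | inj₂ refl | Sign.+ = 1F , 2F , refl , refl , refl , refl
  ... | inj₁ refl | inj₂ refl | Sign.- = 0F , 3F , refl , refl , refl , refl
  ... | inj₂ refl | inj₁ refl | Sign.+ = 2F , 1F , refl , refl , refl , refl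
  ... | inj₂ refl | inj₁ refl | Sign.- = 3F , 0F , refl , refl , refl , refl

  loops : ∀ i → KVert 4 i → i ≢ 0 →
    ∃₂ λ u v → C₄ u v ≡ true × ∣ φ u ∣ ≡ i × ∣ φ v ∣ ≡ i × redSig σ φ u v ≡ Sign.-
  loops i i∈K _ with K₄-vertex i∈K
  ... | inj₁ refl = 0F , 1F , refl , refl , refl , refl
  ... | inj₂ refl = 2F , 3F , refl , refl , refl , refl

  no-other-loops : ∀ u v → C₄ u v ≡ true → ∣ φ u ∣ ≡ ∣ φ v ∣ →
    ∣ φ u ∣ ≢ 0 × redSig σ φ u v ≡ Sign.-
  no-other-loops = toWitness {a? = all? λ u → all? λ v → (C₄ u v Bool.≟ true) →-dec
    ((∣ φ u ∣ ℕ.≟ ∣ φ v ∣) →-dec (¬? (∣ φ u ∣ ℕ.≟ 0) ×-dec (redSig σ φ u v Sign.≟ Sign.-)))} tt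

C₄-achromatic-number : IsPsi C₄ σ₄ 4
C₄-achromatic-number = s≤s z≤n , (unswitched , C₄-4-colouring , C₄-complete-4-colouring) , maximal
  where
  maximal : ∀ j → 1 ≤ j → HasComplete C₄ σ₄ j → j ≤ 4
  maximal j _ (_ , _ , complete) with j ℕ.≤? 4
  ... | yes j≤4 = j≤4
  ... | no  j≰4 = contradiction (complete⇒5≤n C₄-irreflexive complete (ℕ.≰⇒> j≰4)) (ℕ.<-irrefl refl)

theorem5p6 : Σ ℕ λ n → Σ (SGraph n) λ G →
    ¬ ContainsInduced (P 4) (adj G) ×
    ¬ ContainsInduced (P 3 ⊕ P 2) (adj G) ×
    ¬ ContainsInduced (P 2 ⊕ P 2 ⊕ P 2) (adj G) ×
    ¬ Perfect IsPsi IsOmega G ×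
    ¬ Perfect IsPsi IsChi G
theorem5p6 =
  4 , C₄± ,
  C₄-P₄-free ,
  smaller-host⇒¬induced {G = C₄} (ℕ.m<m+n 4 (s≤s z≤n)) ,
  smaller-host⇒¬induced {G = C₄} (ℕ.m<m+n 4 (s≤s z≤n)) ,
  ¬Perfect-whole {IsPsi} {IsOmega} C₄± C₄-achromatic-number C₄-clique-number (λ ()) ,
  ¬Perfect-whole {IsPsi} {IsChi} C₄± C₄-achromatic-number C₄-chromatic-number (λ ())
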